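{- Let $(G,X,H)$ be a feasible configuration with $|V(G)|\ge2$, let $v$ be a vertex of $G$ that is not a separating vertex, and let $x\in X_v$. Let $G'=G\div v$, for $u\in V(G')$ let $X'_u=X_u\setminus N_H(x)$, and let $H'$ be the hypergraph with $V(H')=\bigcup_{u\in V(G')}X'_u$, edge set $E(H')=\{e\in E(H): |i_H(e)\setminus\{x\}|\ge2 \text{ and } i_H(e)\setminus\{x\}\subseteq V(H')\}$, and $i_{H'}(e)=i_H(e)\setminus\{x\}$. Then $(G',X',H')$ is a feasible configuration, and moreover: (a) if $(G,X,H)$ is degree-feasible, then $(G',X',H')$ is degree-feasible; (b) if $(G,X,H)$ is uncolorable, then $(G',X',H')$ is uncolorable.
   Context: Hypergraph $G=(V,E,i)$: finite vertex and edge sets, $i:E\to2^V$ with $|i(e)|\ge2$, parallel edges allowed. $d_G(v)$ is the number of edges containing $v$. $G[Y]$ is the induced subhypergraph on $Y$ (edges $e$ with $i(e)\subseteq Y$); $Y$ is independent if $G[Y]$ has no edges. For a vertex $x$ of $H$, $N_H(x)$ is the set of vertices $y$ such that some edge $e$ of $H$ has $i_H(e)=\{x,y\}$. $G\div v$ is the hypergraph with vertex set $V(G)\setminus\{v\}$, edges those $e$ with $|i_G(e)\setminus\{v\}|\ge2$, and $i_{G\div v}(e)=i_G(e)\setminus\{v\}$. $G$ is connected if any two vertices are joined by a sequence of distinct vertices $v_1,\dots,v_{q+1}$ and distinct edges $e_1,\dots,e_q$ with $\{v_j,v_{j+1}\}\subseteq i(e_j)$. A separating vertex $v$ of $G$: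 $G$ is the union of two induced subhypergraphs $G_1,G_2$ with $V(G_1)\cap V(G_2)=\{v\}$ and $|V(G_i)|\ge2$. A cover of $G$ is a pair $(X,H)$: $X$ assigns pairwise disjoint sets $X_v$ to $v\in V(G)$; $H$ is a hypergraph with $V(H)=\bigcup_vX_v$, each $X_v$ independent in $H$, and for each $e\in E(G)$ a possibly empty matching $M_e$ (pairwise vertex-disjoint edges) in $H[\bigcup_{v\in i_G(e)}X_v]$ whose edges meet each $X_v$, $v\in i_G(e)$, in exactly one vertex, with $E(H)=\bigcup_eM_e$. A feasible configuration is $(G,X,H)$ with $G$ connected and $(X,H)$ a cover of $G$; degree-feasible if $|X_v|\ge d_G(v)$ for all $v$; colorable if there is an independent set $T$ of $H$ with $|T\cap X_v|=1$ for every $v$, uncolorable otherwise. -}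

module Defs where

open import Data.Nat using (ℕ; zero; suc; _≤_; _≡ᵇ_)
open import Data.Fin using (Fin)
open import Data.Fin.Properties using (any?)
open import Data.Fin.Subset
  using (Subset; _∈_; _∉_; _⊆_; _∩_; _∪_; _-_; ⁅_⁆; ∣_∣; Empty)
open import Data.Fin.Subset.Properties using (_∈?_; _⊆?_)
open import Data.Bool using (Bool; true; false; _∧_)
open import Data.Bool.Properties using () renaming (_≟_ to _≟ᵇ_)
open import Data.Vec using (tabulate)
open import Data.Vec.Properties using (≡-dec)
open import Data.Nat.Properties using (_≤?_)
open import Data.List using (List; []; _∷_)
open import Data.List.Relation.Unary.Unique.Propositional using (Unique)
open import Data.Product using (Σ; ∃; ∃-syntax; _×_; _,_)
open import Data.Sum using (_⊎_)
open import Relation.Nullary using (¬_; Dec; yes; no)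
open import Relation.Nullary.Decidable using (⌊_⌋; _×-dec_)
open import Relation.Binary.PropositionalEquality using (_≡_; _≢_)
open import Function.Bundles using (_⇔_)

-- A hypergraph with vertices drawn from the ambient finite type Fin nV
-- and edges drawn from the ambient finite type Fin nE:
--   V(G)  = verts  (a subset of Fin nV)
--   E(G)  = edges  (a subset of Fin nE)
--   i(e)  = inc e  (only meaningful for e ∈ edges)
-- Parallel edges are allowed (distinct edge names may have equal inc).

record Hypergraph (nV nE : ℕ) : Set where
  field
    verts : Subset nV
    edges : Subset nE
    inc   : Fin nE → Subset nV
open Hypergraph public

IsHypergraph : ∀ {nV nE} → Hypergraph nV nE → Set
IsHypergraph G =
  ∀ {e} → e ∈ edges G → (inc G e ⊆ verts G) × (2 ≤ ∣ inc G e ∣)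

filterᵇ : ∀ {n} {P : Fin n → Set} → ((a : Fin n) → Dec (P a)) → Subset n
filterᵇ P? = tabulate (λ a → ⌊ P? a ⌋)

degree : ∀ {nV nE} → Hypergraph nV nE → Fin nV → ℕ
degree G v = ∣ filterᵇ (λ e → (e ∈? edges G) ×-dec (v ∈? inc G e)) ∣

Independent : ∀ {nV nE} → Hypergraph nV nE → Subset nV → Set
Independent G Y = ∀ {e} → e ∈ edges G → ¬ (inc G e ⊆ Y)

data Walk {nV nE} (G : Hypergraph nV nE) : Fin nV → Fin nV → Set where
  stop : ∀ {v} → v ∈ verts G → Walk G v v
  step : ∀ {u w t} (e : Fin nE) → e ∈ edges G → u ∈ inc G e → w ∈ inc G e →
         Walk G w t → Walk G u t

walkVerts : ∀ {nV nE} {G : Hypergraph nV nE} {a b} → Walk G a b → List (Fin nV)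
walkVerts (stop {v} _)            = v ∷ []
walkVerts (step {u} e _ _ _ rest) = u ∷ walkVerts rest

walkEdges : ∀ {nV nE} {G : Hypergraph nV nE} {a b} → Walk G a b → List (Fin nE)
walkEdges (stop _)              = []
walkEdges (step e _ _ _ rest)   = e ∷ walkEdges rest

Path : ∀ {nV nE} → Hypergraph nV nE → Fin nV → Fin nV → Set
Path G a b = Σ (Walk G a b) (λ w → Unique (walkVerts w) × Unique (walkEdges w))

Connected : ∀ {nV nE} → Hypergraph nV nE → Set
Connected G = ∀ {a b} → a ∈ verts G → b ∈ verts G → Path G a b

-- Separating vertex: G is the union of two induced subhypergraphs
-- G[Y₁], G[Y₂] with Y₁ ∩ Y₂ = {v} and |Y₁|, |Y₂| ≥ 2.
-- (Union: V(G) = Y₁ ∪ Y₂ and every edge of G is an edge of G[Y₁] or G[Y₂].)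

SeparatingVertex : ∀ {nV nE} → Hypergraph nV nE → Fin nV → Set
SeparatingVertex G v =
  Σ (Subset _) λ Y₁ → Σ (Subset _) λ Y₂ →
    (Y₁ ∪ Y₂ ≡ verts G) × (Y₁ ∩ Y₂ ≡ ⁅ v ⁆) ×
    (2 ≤ ∣ Y₁ ∣) × (2 ≤ ∣ Y₂ ∣) ×
    (∀ {e} → e ∈ edges G → (inc G e ⊆ Y₁) ⊎ (inc G e ⊆ Y₂))

_÷_ : ∀ {nV nE} → Hypergraph nV nE → Fin nV → Hypergraph nV nE
G ÷ v = record
  { verts = verts G - v
  ; edges = filterᵇ (λ e → (e ∈? edges G) ×-dec (2 ≤? ∣ inc G e - v ∣))
  ; inc   = λ e → inc G e - v
  }

-- Covers.  X v ⊆ Fin nH is the set X_v (only meaningful for v ∈ V(G)).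

IsMatching : ∀ {nH mH} → Hypergraph nH mH → Subset mH → Set
IsMatching H M =
  (M ⊆ edges H) ×
  (∀ {f f'} → f ∈ M → f' ∈ M → f ≢ f' → Empty (inc H f ∩ inc H f'))

record IsCover {nG mG nH mH} (G : Hypergraph nG mG)
               (X : Fin nG → Subset nH) (H : Hypergraph nH mH) : Set where
  field
    hypergraph   : IsHypergraph H
    disjoint     : ∀ {u w} → u ∈ verts G → w ∈ verts G → u ≢ w →
                   Empty (X u ∩ X w)
    vertsH       : ∀ h → (h ∈ verts H) ⇔ (∃[ u ] (u ∈ verts G × h ∈ X u))
    independent  : ∀ {u} → u ∈ verts G → Independent H (X u)
    matchings    :
      Σ (Fin mG → Subset mH) λ M →
        (∀ {e} → e ∈ edges G →
           IsMatching H (M e) ×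
           (∀ {f} → f ∈ M e →
              -- f is an edge of H[⋃_{v ∈ i(e)} X_v]
              (∀ {h} → h ∈ inc H f → ∃[ u ] (u ∈ inc G e × h ∈ X u)) ×
              (∀ {u} → u ∈ inc G e → ∣ inc H f ∩ X u ∣ ≡ 1))) ×
        (∀ {f} → f ∈ edges H → ∃[ e ] (e ∈ edges G × f ∈ M e)) ×
        (∀ {e f} → e ∈ edges G → f ∈ M e → f ∈ edges H)

record Feasible {nG mG nH mH} (G : Hypergraph nG mG)
                (X : Fin nG → Subset nH) (H : Hypergraph nH mH) : Set where
  field
    hypergraphG : IsHypergraph G
    connected   : Connected G
    cover       : IsCover G X H

DegreeFeasible : ∀ {nG mG nH mH} (G : Hypergraph nG mG)
                 (X : Fin nG → Subset nH) (H : Hypergraph nH mH) → Set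
DegreeFeasible G X H =
  Feasible G X H × (∀ {v} → v ∈ verts G → degree G v ≤ ∣ X v ∣)

Colorable : ∀ {nG mG nH mH} (G : Hypergraph nG mG)
            (X : Fin nG → Subset nH) (H : Hypergraph nH mH) → Set
Colorable G X H =
  Σ (Subset _) λ T → (T ⊆ verts H) × Independent H T ×
    (∀ {v} → v ∈ verts G → ∣ T ∩ X v ∣ ≡ 1)

Uncolorable : ∀ {nG mG nH mH} (G : Hypergraph nG mG)
              (X : Fin nG → Subset nH) (H : Hypergraph nH mH) → Set
Uncolorable G X H = ¬ Colorable G X H

neighbours : ∀ {nH mH} → Hypergraph nH mH → Fin nH → Subset nH
neighbours H x =
  filterᵇ (λ y → any? (λ f → (f ∈? edges H) ×-dec
                             ≡-dec _≟ᵇ_ (inc H f) (⁅ x ⁆ ∪ ⁅ y ⁆)))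

reducedX : ∀ {nG mH nH} → Hypergraph nH mH → (Fin nG → Subset nH) →
           Fin nH → Fin nG → Subset nH
reducedX H X x u = X u ∩ filterᵇ (λ y → ¬? (y ∈? neighbours H x))
  where
  open import Relation.Nullary.Decidable using (¬?)

bigUnion : ∀ {nG nH} → Subset nG → (Fin nG → Subset nH) → Subset nH
bigUnion S F = filterᵇ (λ h → any? (λ u → (u ∈? S) ×-dec (h ∈? F u)))

reducedH : ∀ {nG mG nH mH} → Hypergraph nG mG → Fin nG →
           (Fin nG → Subset nH) → Hypergraph nH mH → Fin nH → Hypergraph nH mH
reducedH G v X H x = record
  { verts = V'
  ; edges = filterᵇ (λ f → (f ∈? edges H) ×-dec
                           ((2 ≤? ∣ inc H f - x ∣) ×-dec (inc H f - x ⊆? V')))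
  ; inc   = λ f → inc H f - x
  }
  where
  V' = bigUnion (verts (G ÷ v)) (reducedX H X x)

module Submission where

-- Each matching M_e of the cover is
--     restricted to the edges of H'; the matching axioms of (X', H')
--     follow from those of (X, H) because every vertex of H' lies in
--     exactly one class X_u with u ≠ v.  For degrees, each neighbour of x
--     in X_u is reached through a distinct edge of G through u that
--     disappears in G ÷ v.  A colouring T' of H' extends to the
--     colouring T' ∪ {x} of H, since an edge of H inside T' ∪ {x} either
--     survives in H' or has the form {x, y} with y ∈ N_H(x) ∖ V(H').
--   * Proposition 4 assembles these facts.

open import Defs
open import Data.Nat using (ℕ; zero; suc; _≤_; _+_; z≤n; s≤s)
open import Data.Nat.Properties
  using (≤-trans; ≤-reflexive; +-suc; +-identityʳ; +-monoʳ-≤; +-monoˡ-≤; +-cancelʳ-≤;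
         m≤n+m; ≤-antisym; _≤?_; module ≤-Reasoning)
open import Data.Fin using (Fin; zero; suc; _≟_)
open import Data.Fin.Properties using (any?; suc-injective)
open import Data.Fin.Subset
  using (Subset; inside; outside; _∈_; _∉_; _⊆_; _∩_; _∪_; _─_; _-_; ⁅_⁆; ∣_∣;
         Empty; Nonempty)
open import Data.Fin.Subset.Properties
  using (_∈?_; x∈p∩q⁺; x∈p∩q⁻; x∈p∪q⁺; x∈p∪q⁻; x∈⁅x⁆; x∈⁅y⁆⇒x≡y; ∣⁅x⁆∣≡1;
         x∈p∧x≢y⇒x∈p-y; x∈p∧x∉q⇒x∈p─q; ⊆-antisym; drop-∷-⊆; ∣p∣≤∣x∷p∣;
         p⊆q⇒∣p∣≤∣q∣; p⊆p∪q; q⊆p∪q; p⊂q⇒∣p∣<∣q∣; x∈p⇒∣p-x∣<∣p∣; ∣p∣≤n;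
         ∣p∣≡n⇒p≡⊤; ∈⊤; nonempty?; Empty-unique; ∣⊥∣≡0)
open import Data.Bool.Properties using (T-≡)
open import Data.Vec using ([]; _∷_; here; there)
open import Data.Vec.Properties using ([]=⇒lookup; lookup⇒[]=; lookup∘tabulate)
open import Data.List using (List; []; _∷_)
open import Data.List.Relation.Unary.Any using (here; there)
open import Data.List.Relation.Unary.All using ([]; _∷_)
open import Data.List.Relation.Unary.All.Properties.Core using (¬Any⇒All¬)
open import Data.List.Relation.Unary.AllPairs.Core using ([]; _∷_)
open import Data.List.Relation.Unary.Unique.Propositional using (Unique)
import Data.List.Membership.Propositional as List
import Data.List.Membership.DecPropositional as ListDec
open import Data.Product using (Σ; ∃-syntax; _×_; _,_; proj₁; proj₂)
open import Data.Sum using (_⊎_; inj₁; inj₂)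
open import Data.Empty using (⊥-elim)
open import Relation.Nullary using (¬_; Dec; yes; no)
open import Relation.Nullary.Decidable using (toWitness; fromWitness; _×-dec_; ¬?)
open import Relation.Unary using (Decidable)
open import Relation.Binary.PropositionalEquality
  using (_≡_; _≢_; refl; sym; trans; cong; subst)
open import Function.Bundles using (Equivalence; mk⇔)

∈-filterᵇ⁻ : ∀ {n} {P : Fin n → Set} (P? : Decidable P) {a} → a ∈ filterᵇ P? → P a
∈-filterᵇ⁻ P? {a} a∈ =
  toWitness (Equivalence.from T-≡ (trans (sym (lookup∘tabulate _ a)) ([]=⇒lookup a∈)))

∈-filterᵇ⁺ : ∀ {n} {P : Fin n → Set} (P? : Decidable P) {a} → P a → a ∈ filterᵇ P?
∈-filterᵇ⁺ P? {a} pa =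
  lookup⇒[]= a _ (trans (lookup∘tabulate _ a) (Equivalence.to T-≡ (fromWitness pa)))

∈-─⁻ : ∀ {n} (p q : Subset n) {a} → a ∈ p ─ q → a ∈ p × a ∉ q
∈-─⁻ (s ∷ p) (inside ∷ q) {zero} ()
∈-─⁻ (s ∷ p) (outside ∷ q) {zero} here = here , λ ()
∈-─⁻ (s ∷ p) (t ∷ q) {suc a} (there a∈) with ∈-─⁻ p q a∈
... | a∈p , a∉q = there a∈p , λ { (there a∈q) → a∉q a∈q }

∈--⁻ : ∀ {n} (p : Subset n) (b : Fin n) {a} → a ∈ p - b → a ∈ p × a ≢ b
∈--⁻ p b a∈ with ∈-─⁻ p ⁅ b ⁆ a∈
... | a∈p , a∉b = a∈p , λ { refl → a∉b (x∈⁅x⁆ b) }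

nonempty : ∀ {n} (p : Subset n) → 1 ≤ ∣ p ∣ → Nonempty p
nonempty {n} p 1≤∣p∣ with nonempty? p
... | yes ne = ne
... | no empty with subst (λ q → 1 ≤ ∣ q ∣) (Empty-unique empty) 1≤∣p∣
...   | 1≤∣⊥∣ with subst (1 ≤_) (∣⊥∣≡0 n) 1≤∣⊥∣
...     | ()

two-elements : ∀ {n} (p : Subset n) → 2 ≤ ∣ p ∣ →
               Σ (Fin n) λ a → Σ (Fin n) λ b → a ∈ p × b ∈ p × a ≢ b
two-elements (inside ∷ p) (s≤s 1≤∣p∣) with nonempty p 1≤∣p∣
... | b , b∈p = zero , suc b , here , there b∈p , λ ()
two-elements (outside ∷ p) 2≤∣p∣ with two-elements p 2≤∣p∣
... | a , b , a∈p , b∈p , a≢b =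
  suc a , suc b , there a∈p , there b∈p , λ eq → a≢b (suc-injective eq)

∈⇒1≤∣p∣ : ∀ {n} {p : Subset n} {a} → a ∈ p → 1 ≤ ∣ p ∣
∈⇒1≤∣p∣ here = s≤s z≤n
∈⇒1≤∣p∣ {p = s ∷ p} (there a∈p) = ≤-trans (∈⇒1≤∣p∣ a∈p) (∣p∣≤∣x∷p∣ s p)

distinct⇒2≤∣p∣ : ∀ {n} {p : Subset n} {a b} → a ∈ p → b ∈ p → a ≢ b → 2 ≤ ∣ p ∣
distinct⇒2≤∣p∣ here here a≢b = ⊥-elim (a≢b refl)
distinct⇒2≤∣p∣ here (there b∈p) _ = s≤s (∈⇒1≤∣p∣ b∈p)
distinct⇒2≤∣p∣ (there a∈p) here _ = s≤s (∈⇒1≤∣p∣ a∈p)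
distinct⇒2≤∣p∣ {p = s ∷ p} (there a∈p) (there b∈p) a≢b =
  ≤-trans (distinct⇒2≤∣p∣ a∈p b∈p (λ eq → a≢b (cong suc eq))) (∣p∣≤∣x∷p∣ s p)

∣p∣≡1⇒unique : ∀ {n} {p : Subset n} {a b} → ∣ p ∣ ≡ 1 → a ∈ p → b ∈ p → a ≡ b
∣p∣≡1⇒unique {a = a} {b} ∣p∣≡1 a∈p b∈p with a ≟ b
... | yes a≡b = a≡b
... | no a≢b with subst (2 ≤_) ∣p∣≡1 (distinct⇒2≤∣p∣ a∈p b∈p a≢b)
...   | s≤s ()

unique⇒∣p∣≡1 : ∀ {n} {p : Subset n} {a} → a ∈ p → (∀ {b} → b ∈ p → b ≡ a) → ∣ p ∣ ≡ 1
unique⇒∣p∣≡1 {p = p} {a} a∈p unique = trans (cong ∣_∣ p≡⁅a⁆) (∣⁅x⁆∣≡1 a)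
  where
  p≡⁅a⁆ : p ≡ ⁅ a ⁆
  p≡⁅a⁆ = ⊆-antisym (λ b∈p → subst (_∈ ⁅ a ⁆) (sym (unique b∈p)) (x∈⁅x⁆ a))
                    (λ b∈a → subst (_∈ p) (sym (x∈⁅y⁆⇒x≡y a b∈a)) a∈p)

∈-pair⁻ : ∀ {n} {a b c : Fin n} → c ∈ ⁅ a ⁆ ∪ ⁅ b ⁆ → c ≡ a ⊎ c ≡ b
∈-pair⁻ {a = a} {b} c∈ with x∈p∪q⁻ ⁅ a ⁆ ⁅ b ⁆ c∈
... | inj₁ c∈a = inj₁ (x∈⁅y⁆⇒x≡y a c∈a)
... | inj₂ c∈b = inj₂ (x∈⁅y⁆⇒x≡y b c∈b)

left∈pair : ∀ {n} (a b : Fin n) → a ∈ ⁅ a ⁆ ∪ ⁅ b ⁆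
left∈pair a b = x∈p∪q⁺ (inj₁ (x∈⁅x⁆ a))

right∈pair : ∀ {n} (a b : Fin n) → b ∈ ⁅ a ⁆ ∪ ⁅ b ⁆
right∈pair a b = x∈p∪q⁺ (inj₂ (x∈⁅x⁆ b))

pair-by-removal : ∀ {n} {p : Subset n} {a b} → a ∈ p → b ∈ p - a → ¬ (2 ≤ ∣ p - a ∣) →
                  p ≡ ⁅ a ⁆ ∪ ⁅ b ⁆
pair-by-removal {p = p} {a} {b} a∈p b∈p-a small = ⊆-antisym ⊆pair pair⊆
  where
  ⊆pair : p ⊆ ⁅ a ⁆ ∪ ⁅ b ⁆
  ⊆pair {z} z∈p with z ≟ a | z ≟ b
  ... | yes refl | _ = left∈pair a b
  ... | no _ | yes refl = right∈pair a b
  ... | no z≢a | no z≢b =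
    ⊥-elim (small (distinct⇒2≤∣p∣ (x∈p∧x≢y⇒x∈p-y z∈p z≢a) b∈p-a z≢b))
  pair⊆ : ⁅ a ⁆ ∪ ⁅ b ⁆ ⊆ p
  pair⊆ z∈ with ∈-pair⁻ z∈
  ... | inj₁ refl = a∈p
  ... | inj₂ refl = proj₁ (∈--⁻ p a b∈p-a)

pair-of-small-removal : ∀ {n} (p : Subset n) (a : Fin n) → 2 ≤ ∣ p ∣ → ¬ (2 ≤ ∣ p - a ∣) →
                        Σ (Fin n) λ b → b ∈ p - a × p ≡ ⁅ a ⁆ ∪ ⁅ b ⁆
pair-of-small-removal p a 2≤∣p∣ small with two-elements p 2≤∣p∣
... | c , d , c∈p , d∈p , c≢d with c ≟ a | d ≟ a
...   | yes refl | yes refl = ⊥-elim (c≢d refl)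
...   | yes refl | no d≢a =
  d , x∈p∧x≢y⇒x∈p-y d∈p d≢a , pair-by-removal c∈p (x∈p∧x≢y⇒x∈p-y d∈p d≢a) small
...   | no c≢a | yes refl =
  c , x∈p∧x≢y⇒x∈p-y c∈p c≢a , pair-by-removal d∈p (x∈p∧x≢y⇒x∈p-y c∈p c≢a) small
...   | no c≢a | no d≢a =
  ⊥-elim (small (distinct⇒2≤∣p∣ (x∈p∧x≢y⇒x∈p-y c∈p c≢a) (x∈p∧x≢y⇒x∈p-y d∈p d≢a) c≢d))

∣p∣+∣q∣≤∣r∣ : ∀ {n} (p q r : Subset n) → p ⊆ r → q ⊆ r → (∀ {a} → a ∈ p → a ∉ q) →
             ∣ p ∣ + ∣ q ∣ ≤ ∣ r ∣
∣p∣+∣q∣≤∣r∣ [] [] [] _ _ _ = z≤n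
∣p∣+∣q∣≤∣r∣ (inside ∷ p) (inside ∷ q) (s ∷ r) _ _ disj = ⊥-elim (disj here here)
∣p∣+∣q∣≤∣r∣ (inside ∷ p) (outside ∷ q) (outside ∷ r) p⊆r _ _ with p⊆r here
... | ()
∣p∣+∣q∣≤∣r∣ (inside ∷ p) (outside ∷ q) (inside ∷ r) p⊆r q⊆r disj =
  s≤s (∣p∣+∣q∣≤∣r∣ p q r (drop-∷-⊆ p⊆r) (drop-∷-⊆ q⊆r) (λ a∈p a∈q → disj (there a∈p) (there a∈q)))
∣p∣+∣q∣≤∣r∣ (outside ∷ p) (inside ∷ q) (outside ∷ r) _ q⊆r _ with q⊆r here
... | ()
∣p∣+∣q∣≤∣r∣ (outside ∷ p) (inside ∷ q) (inside ∷ r) p⊆r q⊆r disj =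
  subst (_≤ suc ∣ r ∣) (sym (+-suc ∣ p ∣ ∣ q ∣))
    (s≤s (∣p∣+∣q∣≤∣r∣ p q r (drop-∷-⊆ p⊆r) (drop-∷-⊆ q⊆r) (λ a∈p a∈q → disj (there a∈p) (there a∈q))))
∣p∣+∣q∣≤∣r∣ (outside ∷ p) (outside ∷ q) (s ∷ r) p⊆r q⊆r disj =
  ≤-trans (∣p∣+∣q∣≤∣r∣ p q r (drop-∷-⊆ p⊆r) (drop-∷-⊆ q⊆r) (λ a∈p a∈q → disj (there a∈p) (there a∈q)))
          (∣p∣≤∣x∷p∣ s r)

∣p∪q∣≤∣p∣+∣q∣ : ∀ {n} (p q : Subset n) → ∣ p ∪ q ∣ ≤ ∣ p ∣ + ∣ q ∣
∣p∪q∣≤∣p∣+∣q∣ [] [] = z≤n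
∣p∪q∣≤∣p∣+∣q∣ (inside ∷ p) (s ∷ q) =
  s≤s (≤-trans (∣p∪q∣≤∣p∣+∣q∣ p q) (+-monoʳ-≤ ∣ p ∣ (∣p∣≤∣x∷p∣ s q)))
∣p∪q∣≤∣p∣+∣q∣ (outside ∷ p) (inside ∷ q) =
  subst (suc ∣ p ∪ q ∣ ≤_) (sym (+-suc ∣ p ∣ ∣ q ∣)) (s≤s (∣p∪q∣≤∣p∣+∣q∣ p q))
∣p∪q∣≤∣p∣+∣q∣ (outside ∷ p) (outside ∷ q) = ∣p∪q∣≤∣p∣+∣q∣ p q

∣A∣≤∣B∣-by-injection : ∀ {n m} (A : Subset n) (B : Subset m) (R : Fin n → Fin m → Set) →
  (∀ {a} → a ∈ A → Σ (Fin m) λ b → b ∈ B × R a b) →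
  (∀ {a a' b} → a ∈ A → a' ∈ A → R a b → R a' b → a ≡ a') →
  ∣ A ∣ ≤ ∣ B ∣
∣A∣≤∣B∣-by-injection [] B R total injective = z≤n
∣A∣≤∣B∣-by-injection (outside ∷ A) B R total injective =
  ∣A∣≤∣B∣-by-injection A B (λ a → R (suc a)) (λ a∈A → total (there a∈A))
    (λ a∈A a'∈A r r' → suc-injective (injective (there a∈A) (there a'∈A) r r'))
∣A∣≤∣B∣-by-injection (inside ∷ A) B R total injective with total here
... | b₀ , b₀∈B , r₀ =
  ≤-trans (s≤s (∣A∣≤∣B∣-by-injection A (B - b₀) (λ a → R (suc a)) total' injective'))
          (x∈p⇒∣p-x∣<∣p∣ b₀∈B)
  where
  -- the image of the remaining elements avoids b₀, the image of zero
  total' : ∀ {a} → a ∈ A → Σ (Fin _) λ b → b ∈ B - b₀ × R (suc a) b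
  total' a∈A with total (there a∈A)
  ... | b , b∈B , r = b , x∈p∧x≢y⇒x∈p-y b∈B b≢b₀ , r
    where
    b≢b₀ : b ≢ b₀
    b≢b₀ refl with injective (there a∈A) here r r₀
    ... | ()
  injective' : ∀ {a a' b} → a ∈ A → a' ∈ A → R (suc a) b → R (suc a') b → a ≡ a'
  injective' a∈A a'∈A r r' = suc-injective (injective (there a∈A) (there a'∈A) r r')

data Suffix {A : Set} : List A → List A → Set where
  refl-suffix : ∀ {xs} → Suffix xs xs
  drop-head   : ∀ {xs y ys} → Suffix xs ys → Suffix xs (y ∷ ys)

unique-suffix : ∀ {A : Set} {xs ys : List A} → Suffix xs ys → Unique ys → Unique xs
unique-suffix refl-suffix u = u
unique-suffix (drop-head s) (_ ∷ u) = unique-suffix s u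

∉-suffix : ∀ {A : Set} {a : A} {xs ys : List A} → Suffix xs ys → ¬ (a List.∈ ys) → ¬ (a List.∈ xs)
∉-suffix refl-suffix a∉ys = a∉ys
∉-suffix (drop-head s) a∉ys = ∉-suffix s (λ a∈ys → a∉ys (there a∈ys))

module _ {nV nE} {K : Hypergraph nV nE} where

  tail-at-vertex : ∀ {a b u} (P : Walk K a b) → u List.∈ walkVerts P →
    Σ (Walk K u b) λ Q → Suffix (walkVerts Q) (walkVerts P) × Suffix (walkEdges Q) (walkEdges P)
  tail-at-vertex (stop u∈K) (here refl) = stop u∈K , refl-suffix , refl-suffix
  tail-at-vertex (step e e∈K a∈e w∈e P) (here refl) =
    step e e∈K a∈e w∈e P , refl-suffix , refl-suffix
  tail-at-vertex (step e e∈K a∈e w∈e P) (there u∈P) with tail-at-vertex P u∈P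
  ... | Q , sv , se = Q , drop-head sv , drop-head se

  tail-at-edge : ∀ {a b u e} (P : Walk K a b) → e List.∈ walkEdges P → u ∈ inc K e →
    Σ (Walk K u b) λ Q → Σ (List (Fin nV)) λ rest →
      (walkVerts Q ≡ u ∷ rest) × Suffix rest (walkVerts P) × Suffix (walkEdges Q) (walkEdges P)
  tail-at-edge (stop _) () _
  tail-at-edge (step e e∈K a∈e w∈e P) (here refl) u∈e =
    step e e∈K u∈e w∈e P , walkVerts P , refl , drop-head refl-suffix , refl-suffix
  tail-at-edge (step e e∈K a∈e w∈e P) (there e∈P) u∈e with tail-at-edge P e∈P u∈e
  ... | Q , rest , eq , sv , se = Q , rest , eq , drop-head sv , drop-head se

  -- Every walk can be shortened to a path: if the first vertex or the
  -- first edge recurs later, jump to its later occurrence.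
  walk⇒path : ∀ {a b} → Walk K a b → Path K a b
  walk⇒path (stop a∈K) = stop a∈K , [] ∷ [] , []
  walk⇒path {a} (step e e∈K a∈e w∈e W) with walk⇒path W
  ... | P , uniqueV , uniqueE with ListDec._∈?_ _≟_ a (walkVerts P)
  ...   | yes a∈P with tail-at-vertex P a∈P
  ...     | Q , sv , se = Q , unique-suffix sv uniqueV , unique-suffix se uniqueE
  walk⇒path {a} (step e e∈K a∈e w∈e W) | P , uniqueV , uniqueE | no a∉P
    with ListDec._∈?_ _≟_ e (walkEdges P)
  ... | yes e∈P with tail-at-edge P e∈P a∈e
  ...   | Q , rest , eq , sv , se =
    Q , subst Unique (sym eq) (¬Any⇒All¬ rest (∉-suffix sv a∉P) ∷ unique-suffix sv uniqueV) ,
    unique-suffix se uniqueE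
  walk⇒path {a} (step e e∈K a∈e w∈e W) | P , uniqueV , uniqueE | no a∉P | no e∉P =
    step e e∈K a∈e w∈e P , ¬Any⇒All¬ _ a∉P ∷ uniqueV , ¬Any⇒All¬ _ e∉P ∷ uniqueE

  Closed : Subset nV → Set
  Closed S = ∀ {e w w'} → e ∈ edges K → w ∈ inc K e → w' ∈ inc K e → w ∈ S → w' ∈ S

  Exit : Subset nV → Set
  Exit S = Σ (Fin nE) λ e → Σ (Fin nV) λ w → Σ (Fin nV) λ w' →
             e ∈ edges K × w ∈ inc K e × w' ∈ inc K e × w ∈ S × w' ∉ S

  exit? : (S : Subset nV) → Dec (Exit S)
  exit? S = any? λ e → any? λ w → any? λ w' →
    (e ∈? edges K) ×-dec (w ∈? inc K e) ×-dec (w' ∈? inc K e) ×-dec (w ∈? S) ×-dec ¬? (w' ∈? S)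

  no-exit⇒closed : ∀ {S} → ¬ Exit S → Closed S
  no-exit⇒closed {S} no-exit {e} {w} {w'} e∈K w∈e w'∈e w∈S with w' ∈? S
  ... | yes w'∈S = w'∈S
  ... | no w'∉S = ⊥-elim (no-exit (e , w , w' , e∈K , w∈e , w'∈e , w∈S , w'∉S))

  Reaching : Fin nV → Subset nV → Set
  Reaching b S = b ∈ S × S ⊆ verts K × (∀ {s} → s ∈ S → Walk K s b)

  extend : IsHypergraph K → ∀ {b S e w w'} → Reaching b S →
           e ∈ edges K → w ∈ inc K e → w' ∈ inc K e → w ∈ S → Reaching b (S ∪ ⁅ w' ⁆)
  extend isHyp {S = S} {e} {w} {w'} (b∈S , S⊆K , walks) e∈K w∈e w'∈e w∈S =
    p⊆p∪q ⁅ w' ⁆ b∈S , ⊆K , walks'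
    where
    ⊆K : S ∪ ⁅ w' ⁆ ⊆ verts K
    ⊆K s∈ with x∈p∪q⁻ S ⁅ w' ⁆ s∈
    ... | inj₁ s∈S = S⊆K s∈S
    ... | inj₂ s∈w' rewrite x∈⁅y⁆⇒x≡y w' s∈w' = proj₁ (isHyp e∈K) w'∈e
    walks' : ∀ {s} → s ∈ S ∪ ⁅ w' ⁆ → Walk K s _
    walks' s∈ with x∈p∪q⁻ S ⁅ w' ⁆ s∈
    ... | inj₁ s∈S = walks s∈S
    ... | inj₂ s∈w' rewrite x∈⁅y⁆⇒x≡y w' s∈w' = step e e∈K w'∈e w∈e (walks w∈S)

  -- Growing a reaching set along exit edges ends in a closed reaching
  -- set; the fuel k bounds the number of vertices still to be added.
  grow : IsHypergraph K → ∀ {b} (k : ℕ) (S : Subset nV) → nV ≤ ∣ S ∣ + k → Reaching b S →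
         Σ (Subset nV) λ S' → Reaching b S' × Closed S'
  grow isHyp k S bound reaching with exit? S
  ... | no no-exit = S , reaching , no-exit⇒closed no-exit
  grow isHyp zero S bound reaching | yes (_ , _ , w' , _ , _ , _ , _ , w'∉S) =
    ⊥-elim (w'∉S (subst (w' ∈_) (sym (∣p∣≡n⇒p≡⊤ ∣S∣≡nV)) ∈⊤))
    where
    ∣S∣≡nV : ∣ S ∣ ≡ nV
    ∣S∣≡nV = ≤-antisym (∣p∣≤n S) (subst (nV ≤_) (+-identityʳ _) bound)
  grow isHyp (suc k) S bound reaching | yes (e , w , w' , e∈K , w∈e , w'∈e , w∈S , w'∉S) =
    grow isHyp k (S ∪ ⁅ w' ⁆) bound' (extend isHyp reaching e∈K w∈e w'∈e w∈S)
    where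
    larger : suc ∣ S ∣ ≤ ∣ S ∪ ⁅ w' ⁆ ∣
    larger = p⊂q⇒∣p∣<∣q∣ (p⊆p∪q ⁅ w' ⁆ , w' , q⊆p∪q S ⁅ w' ⁆ (x∈⁅x⁆ w') , w'∉S)
    bound' : nV ≤ ∣ S ∪ ⁅ w' ⁆ ∣ + k
    bound' = ≤-trans bound (subst (_≤ ∣ S ∪ ⁅ w' ⁆ ∣ + k) (sym (+-suc ∣ S ∣ k))
                                  (+-monoˡ-≤ k larger))

  walk-or-cut : IsHypergraph K → ∀ {a b} → a ∈ verts K → b ∈ verts K →
    Walk K a b ⊎ Σ (Subset nV) λ S → b ∈ S × a ∉ S × S ⊆ verts K × Closed S
  walk-or-cut isHyp {a} {b} a∈K b∈K
    with grow isHyp nV ⁅ b ⁆ (m≤n+m nV _) (x∈⁅x⁆ b , ⁅b⁆⊆K , walk-from-b)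
    where
    ⁅b⁆⊆K : ⁅ b ⁆ ⊆ verts K
    ⁅b⁆⊆K s∈ = subst (_∈ verts K) (sym (x∈⁅y⁆⇒x≡y b s∈)) b∈K
    walk-from-b : ∀ {s} → s ∈ ⁅ b ⁆ → Walk K s b
    walk-from-b s∈ = subst (λ s → Walk K s b) (sym (x∈⁅y⁆⇒x≡y b s∈)) (stop b∈K)
  ... | S , (b∈S , S⊆K , walks) , closed with a ∈? S
  ...   | yes a∈S = inj₁ (walks a∈S)
  ...   | no a∉S = inj₂ (S , b∈S , a∉S , S⊆K , closed)

module _ {nV nE} {G : Hypergraph nV nE} {v : Fin nV} where

  ÷-vertex⁻ : ∀ {u} → u ∈ verts (G ÷ v) → u ∈ verts G × u ≢ v
  ÷-vertex⁻ = ∈--⁻ (verts G) v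

  ÷-edge⁻ : ∀ {e} → e ∈ edges (G ÷ v) → e ∈ edges G × 2 ≤ ∣ inc G e - v ∣
  ÷-edge⁻ = ∈-filterᵇ⁻ _

  ÷-edge⁺ : ∀ {e} → e ∈ edges G → 2 ≤ ∣ inc G e - v ∣ → e ∈ edges (G ÷ v)
  ÷-edge⁺ e∈G big = ∈-filterᵇ⁺ _ (e∈G , big)

  ÷-isHypergraph : IsHypergraph G → IsHypergraph (G ÷ v)
  ÷-isHypergraph isHyp e∈G÷v with ÷-edge⁻ e∈G÷v
  ... | e∈G , big = inc⊆ , big
    where
    inc⊆ : inc G _ - v ⊆ verts G - v
    inc⊆ u∈ with ∈--⁻ _ v u∈
    ... | u∈e , u≢v = x∈p∧x≢y⇒x∈p-y (proj₁ (isHyp e∈G) u∈e) u≢v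

  -- A closed set S of G ÷ v containing b but not a splits G into the
  -- induced subhypergraphs on Y₁ = S ∪ {v} and Y₂ = V(G) ∖ S, which meet
  -- exactly in v: an edge of G meeting S outside v has either at least
  -- two vertices besides v (so it is an edge of G ÷ v and lies in S ∪ {v}
  -- by closedness) or exactly one, which lies in S.
  cut⇒separating : IsHypergraph G → v ∈ verts G →
    ∀ {a b} (S : Subset nV) → a ∈ verts (G ÷ v) → b ∈ verts (G ÷ v) → b ∈ S → a ∉ S →
    S ⊆ verts (G ÷ v) → Closed {K = G ÷ v} S → SeparatingVertex G v
  cut⇒separating isHyp v∈G {a} {b} S a∈G÷v b∈G÷v b∈S a∉S S⊆G÷v closed =
    Y₁ , Y₂ , ⊆-antisym ∪⊆ ⊆∪ , ⊆-antisym ∩⊆ ⊆∩ , 2≤∣Y₁∣ , 2≤∣Y₂∣ , edge-side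
    where
    Y₁ Y₂ : Subset nV
    Y₁ = S ∪ ⁅ v ⁆
    Y₂ = verts G ─ S

    v∉S : v ∉ S
    v∉S v∈S = proj₂ (÷-vertex⁻ (S⊆G÷v v∈S)) refl

    v∈Y₁ : v ∈ Y₁
    v∈Y₁ = q⊆p∪q S ⁅ v ⁆ (x∈⁅x⁆ v)

    v∈Y₂ : v ∈ Y₂
    v∈Y₂ = x∈p∧x∉q⇒x∈p─q v∈G v∉S

    ∪⊆ : Y₁ ∪ Y₂ ⊆ verts G
    ∪⊆ u∈ with x∈p∪q⁻ Y₁ Y₂ u∈
    ... | inj₂ u∈Y₂ = proj₁ (∈-─⁻ (verts G) S u∈Y₂)
    ... | inj₁ u∈Y₁ with x∈p∪q⁻ S ⁅ v ⁆ u∈Y₁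
    ...   | inj₁ u∈S = proj₁ (÷-vertex⁻ (S⊆G÷v u∈S))
    ...   | inj₂ u∈v = subst (_∈ verts G) (sym (x∈⁅y⁆⇒x≡y v u∈v)) v∈G

    ⊆∪ : verts G ⊆ Y₁ ∪ Y₂
    ⊆∪ {u} u∈G with u ∈? S
    ... | yes u∈S = p⊆p∪q Y₂ (p⊆p∪q ⁅ v ⁆ u∈S)
    ... | no u∉S = q⊆p∪q Y₁ Y₂ (x∈p∧x∉q⇒x∈p─q u∈G u∉S)

    ∩⊆ : Y₁ ∩ Y₂ ⊆ ⁅ v ⁆
    ∩⊆ u∈ with x∈p∩q⁻ Y₁ Y₂ u∈
    ... | u∈Y₁ , u∈Y₂ with x∈p∪q⁻ S ⁅ v ⁆ u∈Y₁
    ...   | inj₁ u∈S = ⊥-elim (proj₂ (∈-─⁻ (verts G) S u∈Y₂) u∈S)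
    ...   | inj₂ u∈v = u∈v

    ⊆∩ : ⁅ v ⁆ ⊆ Y₁ ∩ Y₂
    ⊆∩ u∈ rewrite x∈⁅y⁆⇒x≡y v u∈ = x∈p∩q⁺ (v∈Y₁ , v∈Y₂)

    2≤∣Y₁∣ : 2 ≤ ∣ Y₁ ∣
    2≤∣Y₁∣ = distinct⇒2≤∣p∣ (p⊆p∪q ⁅ v ⁆ b∈S) v∈Y₁ (proj₂ (÷-vertex⁻ b∈G÷v))

    2≤∣Y₂∣ : 2 ≤ ∣ Y₂ ∣
    2≤∣Y₂∣ = distinct⇒2≤∣p∣ (x∈p∧x∉q⇒x∈p─q (proj₁ (÷-vertex⁻ a∈G÷v)) a∉S) v∈Y₂
                            (proj₂ (÷-vertex⁻ a∈G÷v))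

    edge-side : ∀ {e} → e ∈ edges G → (inc G e ⊆ Y₁) ⊎ (inc G e ⊆ Y₂)
    edge-side {e} e∈G with any? (λ w → (w ∈? inc G e - v) ×-dec (w ∈? S))
    ... | yes (w , w∈e-v , w∈S) = inj₁ inc⊆Y₁
      where
      inc⊆Y₁ : inc G e ⊆ Y₁
      inc⊆Y₁ {u} u∈e with u ≟ v
      ... | yes refl = v∈Y₁
      ... | no u≢v with 2 ≤? ∣ inc G e - v ∣
      ...   | yes big =
        p⊆p∪q ⁅ v ⁆ (closed (÷-edge⁺ e∈G big) w∈e-v (x∈p∧x≢y⇒x∈p-y u∈e u≢v) w∈S)
      ...   | no small with u ≟ w
      ...     | yes refl = p⊆p∪q ⁅ v ⁆ w∈S
      ...     | no u≢w = ⊥-elim (small (distinct⇒2≤∣p∣ (x∈p∧x≢y⇒x∈p-y u∈e u≢v) w∈e-v u≢w))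
    ... | no misses-S = inj₂ inc⊆Y₂
      where
      inc⊆Y₂ : inc G e ⊆ Y₂
      inc⊆Y₂ {u} u∈e = x∈p∧x∉q⇒x∈p─q (proj₁ (isHyp e∈G) u∈e) λ u∈S →
        misses-S (u , x∈p∧x≢y⇒x∈p-y u∈e (proj₂ (÷-vertex⁻ (S⊆G÷v u∈S))) , u∈S)

  ÷-connected : IsHypergraph G → v ∈ verts G → ¬ SeparatingVertex G v → Connected (G ÷ v)
  ÷-connected isHyp v∈G not-separating a∈G÷v b∈G÷v
    with walk-or-cut (÷-isHypergraph isHyp) a∈G÷v b∈G÷v
  ... | inj₁ walk = walk⇒path walk
  ... | inj₂ (S , b∈S , a∉S , S⊆G÷v , closed) =
    ⊥-elim (not-separating (cut⇒separating isHyp v∈G S a∈G÷v b∈G÷v b∈S a∉S S⊆G÷v closed))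

module Reduction {nG mG nH mH} (G : Hypergraph nG mG) (X : Fin nG → Subset nH)
  (H : Hypergraph nH mH) (F : Feasible G X H)
  (v : Fin nG) (v∈G : v ∈ verts G) (x : Fin nH) (x∈Xv : x ∈ X v) where

  open Feasible F
  open IsCover cover

  G' : Hypergraph nG mG
  G' = G ÷ v

  X' : Fin nG → Subset nH
  X' = reducedX H X x

  H' : Hypergraph nH mH
  H' = reducedH G v X H x

  M : Fin mG → Subset mH
  M = proj₁ matchings

  M-matching : ∀ {e} → e ∈ edges G → IsMatching H (M e)
  M-matching e∈G = proj₁ (proj₁ (proj₂ matchings) e∈G)

  M-within : ∀ {e f h} → e ∈ edges G → f ∈ M e → h ∈ inc H f → ∃[ u ] (u ∈ inc G e × h ∈ X u)
  M-within e∈G f∈Me = proj₁ (proj₂ (proj₁ (proj₂ matchings) e∈G) f∈Me)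

  M-meets-once : ∀ {e f u} → e ∈ edges G → f ∈ M e → u ∈ inc G e → ∣ inc H f ∩ X u ∣ ≡ 1
  M-meets-once e∈G f∈Me = proj₂ (proj₂ (proj₁ (proj₂ matchings) e∈G) f∈Me)

  M-covers : ∀ {f} → f ∈ edges H → ∃[ e ] (e ∈ edges G × f ∈ M e)
  M-covers = proj₁ (proj₂ (proj₂ matchings))

  M-unique-in-class : ∀ {e f u h h'} → e ∈ edges G → f ∈ M e → u ∈ inc G e →
    h ∈ inc H f → h ∈ X u → h' ∈ inc H f → h' ∈ X u → h ≡ h'
  M-unique-in-class e∈G f∈Me u∈e h∈f h∈Xu h'∈f h'∈Xu =
    ∣p∣≡1⇒unique (M-meets-once e∈G f∈Me u∈e) (x∈p∩q⁺ (h∈f , h∈Xu)) (x∈p∩q⁺ (h'∈f , h'∈Xu))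

  unique-class : ∀ {h u w} → u ∈ verts G → w ∈ verts G → h ∈ X u → h ∈ X w → u ≡ w
  unique-class {h} {u} {w} u∈G w∈G h∈Xu h∈Xw with u ≟ w
  ... | yes u≡w = u≡w
  ... | no u≢w = ⊥-elim (disjoint u∈G w∈G u≢w (h , x∈p∩q⁺ (h∈Xu , h∈Xw)))

  G'-vertex⁻ : ∀ {u} → u ∈ verts G' → u ∈ verts G × u ≢ v
  G'-vertex⁻ = ÷-vertex⁻ {G = G}

  G'-edge⁻ : ∀ {e} → e ∈ edges G' → e ∈ edges G × 2 ≤ ∣ inc G e - v ∣
  G'-edge⁻ = ÷-edge⁻ {G = G}

  G'-edge⁺ : ∀ {e} → e ∈ edges G → 2 ≤ ∣ inc G e - v ∣ → e ∈ edges G'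
  G'-edge⁺ = ÷-edge⁺ {G = G}

  X'⁻ : ∀ {h u} → h ∈ X' u → h ∈ X u × h ∉ neighbours H x
  X'⁻ {u = u} h∈ with x∈p∩q⁻ (X u) _ h∈
  ... | h∈Xu , h∈filter = h∈Xu , ∈-filterᵇ⁻ _ h∈filter

  X'⁺ : ∀ {h u} → h ∈ X u → h ∉ neighbours H x → h ∈ X' u
  X'⁺ h∈Xu h∉N = x∈p∩q⁺ (h∈Xu , ∈-filterᵇ⁺ _ h∉N)

  H'-vertex⁻ : ∀ {h} → h ∈ verts H' → ∃[ u ] (u ∈ verts G' × h ∈ X' u)
  H'-vertex⁻ = ∈-filterᵇ⁻ _

  H'-vertex⁺ : ∀ {h u} → u ∈ verts G' → h ∈ X' u → h ∈ verts H'
  H'-vertex⁺ {u = u} u∈G' h∈X'u = ∈-filterᵇ⁺ _ (u , u∈G' , h∈X'u)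

  H'-edge⁻ : ∀ {f} → f ∈ edges H' →
             f ∈ edges H × 2 ≤ ∣ inc H f - x ∣ × (inc H f - x ⊆ verts H')
  H'-edge⁻ = ∈-filterᵇ⁻ _

  H'-edge⁺ : ∀ {f} → f ∈ edges H → 2 ≤ ∣ inc H f - x ∣ → inc H f - x ⊆ verts H' →
             f ∈ edges H'
  H'-edge⁺ f∈H big ⊆H' = ∈-filterᵇ⁺ _ (f∈H , big , λ {h} → ⊆H' {h})

  neighbour⁻ : ∀ {y} → y ∈ neighbours H x → ∃[ f ] (f ∈ edges H × inc H f ≡ ⁅ x ⁆ ∪ ⁅ y ⁆)
  neighbour⁻ = ∈-filterᵇ⁻ _

  neighbour⁺ : ∀ {y f} → f ∈ edges H → inc H f ≡ ⁅ x ⁆ ∪ ⁅ y ⁆ → y ∈ neighbours H x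
  neighbour⁺ {f = f} f∈H f≡xy = ∈-filterᵇ⁺ _ (f , f∈H , f≡xy)

  ≢x : ∀ {h u} → u ∈ verts G → u ≢ v → h ∈ X u → h ≢ x
  ≢x u∈G u≢v h∈Xu refl = u≢v (unique-class u∈G v∈G h∈Xu x∈Xv)

  H'-class : ∀ {h u} → h ∈ verts H' → u ∈ verts G → h ∈ X u → h ∈ X' u × u ≢ v
  H'-class h∈H' u∈G h∈Xu with H'-vertex⁻ h∈H'
  ... | w , w∈G' , h∈X'w with G'-vertex⁻ w∈G'
  ...   | w∈G , w≢v with unique-class w∈G u∈G (proj₁ (X'⁻ h∈X'w)) h∈Xu
  ...     | refl = h∈X'w , w≢v

  H'-class-in-edge : ∀ {e f h} → e ∈ edges G → f ∈ M e → h ∈ inc H f → h ∈ verts H' →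
                     ∃[ u ] (u ∈ inc G e - v × h ∈ X' u × h ∈ X u)
  H'-class-in-edge e∈G f∈Me h∈f h∈H' with M-within e∈G f∈Me h∈f
  ... | u , u∈e , h∈Xu with H'-class h∈H' (proj₁ (hypergraphG e∈G) u∈e) h∈Xu
  ...   | h∈X'u , u≢v = u , x∈p∧x≢y⇒x∈p-y u∈e u≢v , h∈X'u , h∈Xu

  M' : Fin mG → Subset mH
  M' e = M e ∩ edges H'

  H'-isHypergraph : IsHypergraph H'
  H'-isHypergraph f∈H' with H'-edge⁻ f∈H'
  ... | _ , big , ⊆H' = (λ {h} → ⊆H' {h}) , big

  X'-disjoint : ∀ {u w} → u ∈ verts G' → w ∈ verts G' → u ≢ w → Empty (X' u ∩ X' w)
  X'-disjoint {u} {w} u∈G' w∈G' u≢w (h , h∈) with x∈p∩q⁻ (X' u) (X' w) h∈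
  ... | h∈X'u , h∈X'w =
    disjoint (proj₁ (G'-vertex⁻ u∈G')) (proj₁ (G'-vertex⁻ w∈G')) u≢w
      (h , x∈p∩q⁺ (proj₁ (X'⁻ h∈X'u) , proj₁ (X'⁻ h∈X'w)))

  -- An edge of H' has two vertices besides x; inside one class X_u they
  -- would be two vertices of an edge of M_e in the same class.
  X'-independent : ∀ {u} → u ∈ verts G' → Independent H' (X' u)
  X'-independent u∈G' {f} f∈H' f⊆X'u with H'-edge⁻ f∈H'
  ... | f∈H , big , _ with two-elements _ big | M-covers f∈H
  ...   | h , h' , h∈f-x , h'∈f-x , h≢h' | e , e∈G , f∈Me
    with M-within e∈G f∈Me (proj₁ (∈--⁻ _ x h∈f-x))
  ...     | w , w∈e , h∈Xw
    with unique-class (proj₁ (G'-vertex⁻ u∈G')) (proj₁ (hypergraphG e∈G) w∈e)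
                      (proj₁ (X'⁻ (f⊆X'u h∈f-x))) h∈Xw
  ...       | refl =
    h≢h' (M-unique-in-class e∈G f∈Me w∈e (proj₁ (∈--⁻ _ x h∈f-x)) h∈Xw
                                         (proj₁ (∈--⁻ _ x h'∈f-x)) (proj₁ (X'⁻ (f⊆X'u h'∈f-x))))

  M'-matching : ∀ {e} → e ∈ edges G' → IsMatching H' (M' e)
  M'-matching {e} e∈G' = p∩q⊆q , vertex-disjoint
    where
    p∩q⊆q : M' e ⊆ edges H'
    p∩q⊆q f∈ = proj₂ (x∈p∩q⁻ (M e) _ f∈)
    vertex-disjoint : ∀ {f f'} → f ∈ M' e → f' ∈ M' e → f ≢ f' → Empty (inc H' f ∩ inc H' f')
    vertex-disjoint {f} {f'} f∈ f'∈ f≢f' (h , h∈) with x∈p∩q⁻ (inc H' f) (inc H' f') h∈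
    ... | h∈f , h∈f' =
      proj₂ (M-matching (proj₁ (G'-edge⁻ e∈G'))) (proj₁ (x∈p∩q⁻ (M e) _ f∈))
        (proj₁ (x∈p∩q⁻ (M e) _ f'∈)) f≢f'
        (h , x∈p∩q⁺ (proj₁ (∈--⁻ _ x h∈f) , proj₁ (∈--⁻ _ x h∈f')))

  M'-within : ∀ {e f h} → e ∈ edges G' → f ∈ M' e → h ∈ inc H' f →
              ∃[ u ] (u ∈ inc G' e × h ∈ X' u)
  M'-within {e} e∈G' f∈ h∈f-x with x∈p∩q⁻ (M e) _ f∈
  ... | f∈Me , f∈H' with H'-class-in-edge (proj₁ (G'-edge⁻ e∈G')) f∈Me
                           (proj₁ (∈--⁻ _ x h∈f-x)) (proj₂ (proj₂ (H'-edge⁻ f∈H')) h∈f-x)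
  ...   | u , u∈e-v , h∈X'u , _ = u , u∈e-v , h∈X'u

  -- The unique vertex of an edge f ∈ M_e in X_u (u ≠ v) is not x, hence
  -- a vertex of H', hence in X'_u.
  M'-meets-once : ∀ {e f u} → e ∈ edges G' → f ∈ M' e → u ∈ inc G' e →
                  ∣ inc H' f ∩ X' u ∣ ≡ 1
  M'-meets-once {e} {f} {u} e∈G' f∈ u∈e-v = unique⇒∣p∣≡1 (x∈p∩q⁺ (a∈f-x , a∈X'u)) unique
    where
    e∈G : e ∈ edges G
    e∈G = proj₁ (G'-edge⁻ e∈G')
    f∈Me : f ∈ M e
    f∈Me = proj₁ (x∈p∩q⁻ (M e) _ f∈)
    u∈e : u ∈ inc G e
    u∈e = proj₁ (∈--⁻ _ v u∈e-v)
    u∈G : u ∈ verts G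
    u∈G = proj₁ (hypergraphG e∈G) u∈e
    meet : Nonempty (inc H f ∩ X u)
    meet = nonempty _ (≤-reflexive (sym (M-meets-once e∈G f∈Me u∈e)))
    a : Fin nH
    a = proj₁ meet
    a∈f : a ∈ inc H f
    a∈f = proj₁ (x∈p∩q⁻ (inc H f) (X u) (proj₂ meet))
    a∈Xu : a ∈ X u
    a∈Xu = proj₂ (x∈p∩q⁻ (inc H f) (X u) (proj₂ meet))
    a∈f-x : a ∈ inc H f - x
    a∈f-x = x∈p∧x≢y⇒x∈p-y a∈f (≢x u∈G (proj₂ (∈--⁻ _ v u∈e-v)) a∈Xu)
    a∈X'u : a ∈ X' u
    a∈X'u = proj₁ (H'-class (proj₂ (proj₂ (H'-edge⁻ (proj₂ (x∈p∩q⁻ (M e) _ f∈)))) a∈f-x) u∈G a∈Xu)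
    unique : ∀ {b} → b ∈ inc H' f ∩ X' u → b ≡ a
    unique b∈ with x∈p∩q⁻ (inc H' f) (X' u) b∈
    ... | b∈f-x , b∈X'u =
      M-unique-in-class e∈G f∈Me u∈e (proj₁ (∈--⁻ _ x b∈f-x)) (proj₁ (X'⁻ b∈X'u)) a∈f a∈Xu

  -- An edge of H' comes from some M_e; its two vertices besides x lie in
  -- distinct classes of i(e) ∖ {v}, so e survives in G ÷ v.
  M'-covers : ∀ {f} → f ∈ edges H' → ∃[ e ] (e ∈ edges G' × f ∈ M' e)
  M'-covers {f} f∈H' with H'-edge⁻ f∈H'
  ... | f∈H , big , ⊆H' with M-covers f∈H | two-elements _ big
  ...   | e , e∈G , f∈Me | h , h' , h∈f-x , h'∈f-x , h≢h'
    with H'-class-in-edge e∈G f∈Me (proj₁ (∈--⁻ _ x h∈f-x)) (⊆H' h∈f-x)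
       | H'-class-in-edge e∈G f∈Me (proj₁ (∈--⁻ _ x h'∈f-x)) (⊆H' h'∈f-x)
  ...     | u , u∈e-v , _ , h∈Xu | u' , u'∈e-v , _ , h'∈Xu' =
    e , G'-edge⁺ e∈G (distinct⇒2≤∣p∣ u∈e-v u'∈e-v u≢u') , x∈p∩q⁺ (f∈Me , f∈H')
    where
    u≢u' : u ≢ u'
    u≢u' refl = h≢h' (M-unique-in-class e∈G f∈Me (proj₁ (∈--⁻ _ v u∈e-v))
                        (proj₁ (∈--⁻ _ x h∈f-x)) h∈Xu (proj₁ (∈--⁻ _ x h'∈f-x)) h'∈Xu')

  reduced-isCover : IsCover G' X' H'
  reduced-isCover = record
    { hypergraph  = H'-isHypergraph
    ; disjoint    = X'-disjoint
    ; vertsH      = λ h → mk⇔ H'-vertex⁻ (λ { (u , u∈G' , h∈X'u) → H'-vertex⁺ u∈G' h∈X'u })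
    ; independent = X'-independent
    ; matchings   =
        M' , (λ e∈G' → M'-matching e∈G' , λ f∈ → M'-within e∈G' f∈ , M'-meets-once e∈G' f∈) ,
        M'-covers , (λ _ f∈ → proj₂ (x∈p∩q⁻ (M _) _ f∈))
    }

  -- If an edge f ∈ M_e is {x, y}, then y is the vertex of f in every class
  -- X_w with w ∈ i(e) ∖ {v} (the vertex x lies in X_v).
  pair-edge-class : ∀ {e f y w} → e ∈ edges G → f ∈ M e → inc H f ≡ ⁅ x ⁆ ∪ ⁅ y ⁆ →
                    w ∈ inc G e - v → y ∈ X w
  pair-edge-class {e} {f} {y} {w} e∈G f∈Me f≡xy w∈e-v
    with ∈--⁻ _ v w∈e-v
  ... | w∈e , w≢v with nonempty _ (≤-reflexive (sym (M-meets-once e∈G f∈Me w∈e)))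
  ...   | a , a∈ with x∈p∩q⁻ (inc H f) (X w) a∈
  ...     | a∈f , a∈Xw with ∈-pair⁻ (subst (a ∈_) f≡xy a∈f)
  ...       | inj₁ refl = ⊥-elim (≢x (proj₁ (hypergraphG e∈G) w∈e) w≢v a∈Xw refl)
  ...       | inj₂ refl = a∈Xw

  -- Hence an edge of G carrying such an edge {x, y} has at most one
  -- vertex besides v: its classes besides X_v would all contain y.
  pair-edge-small : ∀ {e f y} → e ∈ edges G → f ∈ M e → inc H f ≡ ⁅ x ⁆ ∪ ⁅ y ⁆ →
                    ¬ (2 ≤ ∣ inc G e - v ∣)
  pair-edge-small e∈G f∈Me f≡xy big with two-elements _ big
  ... | w , w' , w∈e-v , w'∈e-v , w≢w' =
    w≢w' (unique-class (proj₁ (hypergraphG e∈G) (proj₁ (∈--⁻ _ v w∈e-v)))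
                       (proj₁ (hypergraphG e∈G) (proj₁ (∈--⁻ _ v w'∈e-v)))
                       (pair-edge-class e∈G f∈Me f≡xy w∈e-v)
                       (pair-edge-class e∈G f∈Me f≡xy w'∈e-v))

  -- For u ∈ V(G ÷ v) let N = X_u ∩ N_H(x) and let C be the set of
  -- edges of G through u that disappear in G ÷ v.  Each y ∈ N is carried
  -- by a distinct edge of C, so
  --   d_{G÷v}(u) + ∣ N ∣ ≤ d_{G÷v}(u) + ∣ C ∣ ≤ d_G(u) ≤ ∣ X_u ∣ ≤ ∣ X'_u ∣ + ∣ N ∣.
  module Degree {u} (u∈G' : u ∈ verts G') where

    u∈G : u ∈ verts G
    u∈G = proj₁ (G'-vertex⁻ u∈G')

    D' D C : Subset mG
    D' = filterᵇ (λ e → (e ∈? edges G') ×-dec (u ∈? inc G' e))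
    D  = filterᵇ (λ e → (e ∈? edges G) ×-dec (u ∈? inc G e))
    C  = filterᵇ (λ e → (e ∈? edges G) ×-dec (u ∈? inc G e) ×-dec ¬? (2 ≤? ∣ inc G e - v ∣))

    N : Subset nH
    N = X u ∩ neighbours H x

    Carries : Fin nH → Fin mG → Set
    Carries y e = e ∈ edges G × ∃[ f ] (f ∈ M e × inc H f ≡ ⁅ x ⁆ ∪ ⁅ y ⁆)

    carrier : ∀ {y} → y ∈ N → ∃[ e ] (e ∈ C × Carries y e)
    carrier {y} y∈N with x∈p∩q⁻ (X u) _ y∈N
    ... | y∈Xu , y∈Nx with neighbour⁻ y∈Nx
    ...   | f , f∈H , f≡xy with M-covers f∈H
    ...     | e , e∈G , f∈Me with M-within e∈G f∈Me (subst (y ∈_) (sym f≡xy) (right∈pair x y))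
    ...       | w , w∈e , y∈Xw with unique-class (proj₁ (hypergraphG e∈G) w∈e) u∈G y∈Xw y∈Xu
    ...         | refl =
      e , ∈-filterᵇ⁺ _ (e∈G , w∈e , pair-edge-small e∈G f∈Me f≡xy) , e∈G , f , f∈Me , f≡xy

    -- Distinct edges {x, y}, {x, y'} of one matching M_e are impossible, as
    -- both contain x; and {x, y} = {x, y'} forces y = y' since y ≠ x.
    carrier-injective : ∀ {y y' e} → y ∈ N → y' ∈ N → Carries y e → Carries y' e → y ≡ y'
    carrier-injective {y} {y'} y∈N y'∈N (e∈G , f , f∈Me , f≡xy) (_ , f' , f'∈Me , f'≡xy')
      with f ≟ f'
    ... | no f≢f' =
      ⊥-elim (proj₂ (M-matching e∈G) f∈Me f'∈Me f≢f'
               (x , x∈p∩q⁺ (subst (x ∈_) (sym f≡xy) (left∈pair x y) ,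
                            subst (x ∈_) (sym f'≡xy') (left∈pair x y'))))
    ... | yes refl with ∈-pair⁻ (subst (y ∈_) f'≡xy' (subst (y ∈_) (sym f≡xy) (right∈pair x y)))
    ...   | inj₂ y≡y' = y≡y'
    ...   | inj₁ y≡x =
      ⊥-elim (≢x u∈G (proj₂ (G'-vertex⁻ u∈G')) (proj₁ (x∈p∩q⁻ (X u) _ y∈N)) y≡x)

    ∣N∣≤∣C∣ : ∣ N ∣ ≤ ∣ C ∣
    ∣N∣≤∣C∣ = ∣A∣≤∣B∣-by-injection N C Carries carrier carrier-injective

    -- The edges through u are those surviving in G ÷ v and those of C.
    ∣D'∣+∣C∣≤∣D∣ : ∣ D' ∣ + ∣ C ∣ ≤ ∣ D ∣
    ∣D'∣+∣C∣≤∣D∣ = ∣p∣+∣q∣≤∣r∣ D' C D D'⊆D C⊆D D'∩C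
      where
      D'⊆D : D' ⊆ D
      D'⊆D e∈ with ∈-filterᵇ⁻ _ e∈
      ... | e∈G' , u∈e-v = ∈-filterᵇ⁺ _ (proj₁ (G'-edge⁻ e∈G') , proj₁ (∈--⁻ _ v u∈e-v))
      C⊆D : C ⊆ D
      C⊆D e∈ with ∈-filterᵇ⁻ _ e∈
      ... | e∈G , u∈e , _ = ∈-filterᵇ⁺ _ (e∈G , u∈e)
      D'∩C : ∀ {e} → e ∈ D' → e ∉ C
      D'∩C e∈D' e∈C = proj₂ (proj₂ (∈-filterᵇ⁻ _ e∈C)) (proj₂ (G'-edge⁻ (proj₁ (∈-filterᵇ⁻ _ e∈D'))))

    ∣Xu∣≤∣X'u∣+∣N∣ : ∣ X u ∣ ≤ ∣ X' u ∣ + ∣ N ∣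
    ∣Xu∣≤∣X'u∣+∣N∣ = ≤-trans (p⊆q⇒∣p∣≤∣q∣ Xu⊆) (∣p∪q∣≤∣p∣+∣q∣ (X' u) N)
      where
      Xu⊆ : X u ⊆ X' u ∪ N
      Xu⊆ {y} y∈Xu with y ∈? neighbours H x
      ... | yes y∈Nx = q⊆p∪q (X' u) N (x∈p∩q⁺ (y∈Xu , y∈Nx))
      ... | no y∉Nx = p⊆p∪q N (X'⁺ y∈Xu y∉Nx)

    degree-bound : (∀ {w} → w ∈ verts G → degree G w ≤ ∣ X w ∣) → degree G' u ≤ ∣ X' u ∣
    degree-bound degree-feasible = +-cancelʳ-≤ (∣ N ∣) (∣ D' ∣) (∣ X' u ∣) (begin
      ∣ D' ∣ + ∣ N ∣    ≤⟨ +-monoʳ-≤ (∣ D' ∣) ∣N∣≤∣C∣ ⟩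
      ∣ D' ∣ + ∣ C ∣    ≤⟨ ∣D'∣+∣C∣≤∣D∣ ⟩
      ∣ D ∣             ≤⟨ degree-feasible u∈G ⟩
      ∣ X u ∣           ≤⟨ ∣Xu∣≤∣X'u∣+∣N∣ ⟩
      ∣ X' u ∣ + ∣ N ∣  ∎)
      where open ≤-Reasoning

  H'∩Xv-empty : ∀ {h} → h ∈ verts H' → h ∉ X v
  H'∩Xv-empty h∈H' h∈Xv = proj₂ (H'-class h∈H' v∈G h∈Xv) refl

  module Extension (T' : Subset nH) (T'⊆H' : T' ⊆ verts H') (T'-independent : Independent H' T')
                   (T'-meets-once : ∀ {u} → u ∈ verts G' → ∣ T' ∩ X' u ∣ ≡ 1) where

    T : Subset nH
    T = T' ∪ ⁅ x ⁆

    ∈T⁻ : ∀ {h} → h ∈ T → h ∈ T' ⊎ h ≡ x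
    ∈T⁻ h∈T with x∈p∪q⁻ T' ⁅ x ⁆ h∈T
    ... | inj₁ h∈T' = inj₁ h∈T'
    ... | inj₂ h∈x = inj₂ (x∈⁅y⁆⇒x≡y x h∈x)

    T⊆H : T ⊆ verts H
    T⊆H h∈T with ∈T⁻ h∈T
    ... | inj₂ refl = Equivalence.from (vertsH x) (v , v∈G , x∈Xv)
    ... | inj₁ h∈T' with H'-vertex⁻ (T'⊆H' h∈T')
    ...   | u , u∈G' , h∈X'u =
      Equivalence.from (vertsH _) (u , proj₁ (G'-vertex⁻ u∈G') , proj₁ (X'⁻ h∈X'u))

    -- An edge f of H inside T either keeps two vertices besides x, and is
    -- then an edge of H' inside T', or is {x, y} with y ∈ T' ⊆ V(H');
    -- but then y ∈ N_H(x), which V(H') avoids.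
    T-independent : Independent H T
    T-independent {f} f∈H f⊆T with 2 ≤? ∣ inc H f - x ∣
    ... | yes big = T'-independent (H'-edge⁺ f∈H big (λ {h} h∈ → T'⊆H' (f-x⊆T' h∈))) f-x⊆T'
      where
      f-x⊆T' : inc H f - x ⊆ T'
      f-x⊆T' h∈ with ∈--⁻ _ x h∈
      ... | h∈f , h≢x with ∈T⁻ (f⊆T h∈f)
      ...   | inj₁ h∈T' = h∈T'
      ...   | inj₂ h≡x = ⊥-elim (h≢x h≡x)
    ... | no small with pair-of-small-removal (inc H f) x (proj₂ (hypergraph f∈H)) small
    ...   | y , y∈f-x , f≡xy with ∈--⁻ _ x y∈f-x
    ...     | y∈f , y≢x with ∈T⁻ (f⊆T y∈f)
    ...       | inj₂ y≡x = y≢x y≡x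
    ...       | inj₁ y∈T' with H'-vertex⁻ (T'⊆H' y∈T')
    ...         | _ , _ , y∈X'u = proj₂ (X'⁻ y∈X'u) (neighbour⁺ f∈H f≡xy)

    -- X_v meets T in x alone, and X_w (w ≠ v) meets T in the vertex where
    -- it meets T'.
    T-meets-once : ∀ {w} → w ∈ verts G → ∣ T ∩ X w ∣ ≡ 1
    T-meets-once {w} w∈G with w ≟ v
    ... | yes refl = unique⇒∣p∣≡1 (x∈p∩q⁺ (q⊆p∪q T' ⁅ x ⁆ (x∈⁅x⁆ x) , x∈Xv)) only-x
      where
      only-x : ∀ {b} → b ∈ T ∩ X w → b ≡ x
      only-x b∈ with x∈p∩q⁻ T (X w) b∈
      ... | b∈T , b∈Xv with ∈T⁻ b∈T
      ...   | inj₂ b≡x = b≡x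
      ...   | inj₁ b∈T' = ⊥-elim (H'∩Xv-empty (T'⊆H' b∈T') b∈Xv)
    ... | no w≢v = unique⇒∣p∣≡1 (x∈p∩q⁺ (p⊆p∪q ⁅ x ⁆ a∈T' , proj₁ (X'⁻ a∈X'w))) only-a
      where
      w∈G' : w ∈ verts G'
      w∈G' = x∈p∧x≢y⇒x∈p-y w∈G w≢v
      meet : Nonempty (T' ∩ X' w)
      meet = nonempty _ (≤-reflexive (sym (T'-meets-once w∈G')))
      a∈T' : proj₁ meet ∈ T'
      a∈T' = proj₁ (x∈p∩q⁻ T' (X' w) (proj₂ meet))
      a∈X'w : proj₁ meet ∈ X' w
      a∈X'w = proj₂ (x∈p∩q⁻ T' (X' w) (proj₂ meet))
      only-a : ∀ {b} → b ∈ T ∩ X w → b ≡ proj₁ meet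
      only-a b∈ with x∈p∩q⁻ T (X w) b∈
      ... | b∈T , b∈Xw with ∈T⁻ b∈T
      ...   | inj₂ refl = ⊥-elim (≢x w∈G w≢v b∈Xw refl)
      ...   | inj₁ b∈T' =
        ∣p∣≡1⇒unique (T'-meets-once w∈G')
          (x∈p∩q⁺ (b∈T' , proj₁ (H'-class (T'⊆H' b∈T') w∈G b∈Xw))) (proj₂ meet)

  extend-colouring : Colorable G' X' H' → Colorable G X H
  extend-colouring (T' , T'⊆H' , T'-independent , T'-meets-once) =
    T , T⊆H , T-independent , T-meets-once
    where open Extension T' T'⊆H' T'-independent T'-meets-once

proposition4 : ∀ {nG mG nH mH} (G : Hypergraph nG mG) (X : Fin nG → Subset nH)
    (H : Hypergraph nH mH) → Feasible G X H → 2 ≤ ∣ verts G ∣ →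
    (v : Fin nG) → v ∈ verts G → ¬ SeparatingVertex G v →
    (x : Fin nH) → x ∈ X v →
    Feasible (G ÷ v) (reducedX H X x) (reducedH G v X H x) ×
    (DegreeFeasible G X H → DegreeFeasible (G ÷ v) (reducedX H X x) (reducedH G v X H x)) ×
    (Uncolorable G X H → Uncolorable (G ÷ v) (reducedX H X x) (reducedH G v X H x))
proposition4 G X H F _ v v∈G not-separating x x∈Xv =
  feasible' , (λ { (_ , degree-feasible) →
                   feasible' , λ u∈G' → Degree.degree-bound u∈G' degree-feasible }) ,
  (λ uncolourable colouring' → uncolourable (extend-colouring colouring'))
  where
  open Reduction G X H F v v∈G x x∈Xv
  feasible' : Feasible G' X' H'
  feasible' = record
    { hypergraphG = ÷-isHypergraph (Feasible.hypergraphG F)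
    ; connected   = ÷-connected (Feasible.hypergraphG F) v∈G not-separating
    ; cover       = reduced-isCover
    }
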